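{- Let $G$ be a totally decomposable graph with reduced clique-star split-decomposition tree $T$. Then $G$ contains no induced complete subgraph on 4 or more vertices if and only if $T$ has (i) no clique-node of degree 4 or more, and (ii) no alternated path between (a marker vertex of) a clique-node and (a marker vertex of) a different clique-node.
   Context: All graphs are finite, simple and connected. A graph-labeled tree $(T,\mathcal{F})$ is a tree $T$ in which each internal node $v$, of degree $k$, carries a graph $G_v$ on $k$ vertices (its marker vertices) and a bijection $\rho_v$ from the tree edges incident to $v$ onto $V(G_v)$; edges of $G_v$ are interior edges. A clique-node is an internal node $v$ with $G_v$ complete; a star-node is one with $G_v$ a star $K_{1,k-1}$, whose vertex adjacent to all others is its center and whose other vertices are its extremities. Form the auxiliary graph whose vertices are the leaves of $T$ and all marker vertices, and whose edges are all interior edges together with, for each tree edge $e=\{v,w\}$, an edge joining $\rho_v(e)$ (or $v$ if $v$ is a leaf) to $\rho_w(e)$ (or $w$ if $w$ is a leaf). An alternated path is a path in this auxiliary graph containing at most one interior edge of each $G_v$. The accessibility graph of $(T,\mathcal{F})$ has the leaves of $T$ as vertices, two leaves being adjacent iff an alternated path joins them. A split of a graph $H$ is a bipartition $(V_1,V_2)$ of $V(H)$ with $|V_1|,|V_2|\ge 2$ such that every vertex of $V_1$ with a neighbour in $V_2$ is adjacent to every vertex of $V_2$ with a neighbour in $V_1$; a graph with no split is prime. (Cunningham) Every connected graph $G$ is the accessibility graph, with leaves identified with $V(G)$, of a unique graph-labeled tree, its reduced split-decomposition tree, in which every label is a prime graph, a clique or a star, every internal node has degree at least 3, no tree edge joins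 two clique-nodes, and no tree edge joins the center of a star-node to an extremity of another star-node. It is a clique-star tree if all labels are cliques or stars, and $G$ is then called totally decomposable (equivalently, distance-hereditary). -}

module Defs where

open import Data.Nat using (ℕ; zero; suc; _+_; _≤_; _<_)
open import Data.Fin using (Fin; zero; suc) renaming (_≟_ to _≟F_)
open import Data.Bool using (Bool; true; false; T; _∧_; if_then_else_)
open import Data.Sum using (_⊎_; inj₁; inj₂)
open import Data.Product using (Σ; _×_; _,_)
open import Data.List using (List; []; _∷_)
open import Data.List.Relation.Unary.Linked using (Linked)
open import Data.List.Relation.Unary.Unique.Propositional using (Unique)
open import Data.Empty using (⊥)
open import Relation.Binary.PropositionalEquality using (_≡_; _≢_)
open import Relation.Nullary using (¬_; does)
open import Function.Bundles using (_⇔_)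
open import Function.Definitions using (Injective)

record Graph (n : ℕ) : Set where
  field
    adj    : Fin n → Fin n → Bool
    irrefl : ∀ x → adj x x ≡ false
    sym    : ∀ x y → adj x y ≡ adj y x

Adj : ∀ {n} → Graph n → Fin n → Fin n → Set
Adj G x y = T (Graph.adj G x y)

lastOf : ∀ {A : Set} → A → List A → A
lastOf x []       = x
lastOf x (y ∷ ys) = lastOf y ys

record Path {A : Set} (R : A → A → Set) (x y : A) : Set where
  constructor path
  field
    rest     : List A
    linked   : Linked R (x ∷ rest)
    ends     : lastOf x rest ≡ y
    distinct : Unique (x ∷ rest)

Connected : ∀ {n} → Graph n → Set
Connected {n} G = ∀ (x y : Fin n) → Path (Adj G) x y

HasLargeClique : ∀ {n} → Graph n → Set
HasLargeClique {n} G =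
  Σ ℕ λ m → 4 ≤ m × Σ (Fin m → Fin n) λ f →
    Injective _≡_ _≡_ f × (∀ p q → p ≢ q → Adj G (f p) (f q))

countFin : ∀ {m} → (Fin m → Bool) → ℕ
countFin {zero}  f = 0
countFin {suc m} f = (if f zero then 1 else 0) + countFin (λ i → f (suc i))

-- Tree nodes: leaves inj₁ x (x ∈ V(G) = Fin n) and internal nodes inj₂ i.
-- The marker vertex ρ_v(e) of an internal node v for the tree edge
-- e = {v,w} is identified with (v , w); thus the label G_v is a graph on
-- the tree-neighbours of v, given by lab v (restricted to neighbours).

Node : ℕ → ℕ → Set
Node n k = Fin n ⊎ Fin k

record GLT (n k : ℕ) : Set where
  field
    E          : Node n k → Node n k → Bool
    E-irrefl   : ∀ v → E v v ≡ false
    E-sym      : ∀ v w → E v w ≡ E w v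
    lab        : Fin k → Node n k → Node n k → Bool
    lab-irrefl : ∀ i a → lab i a a ≡ false
    lab-sym    : ∀ i a b → lab i a b ≡ lab i b a

module _ {n k : ℕ} (t : GLT n k) where
  open GLT t

  TE : Node n k → Node n k → Set
  TE v w = T (E v w)

  deg : Node n k → ℕ
  deg v = countFin (λ x → E v (inj₁ x)) + countFin (λ i → E v (inj₂ i))

  IsTree : Set
  IsTree = (∀ u v → Path TE u v)
         × (∀ u v (p q : Path TE u v) → Path.rest p ≡ Path.rest q)

  IsMarker : Fin k → Node n k → Set
  IsMarker i a = TE (inj₂ i) a

  Clique : Fin k → Set
  Clique i = ∀ a b → IsMarker i a → IsMarker i b → a ≢ b → T (lab i a b)

  StarWithCenter : Fin k → Node n k → Set
  StarWithCenter i c =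
    IsMarker i c ×
    (∀ a b → IsMarker i a → IsMarker i b → a ≢ b →
       (T (lab i a b) ⇔ (a ≡ c ⊎ b ≡ c)))

  Star : Fin k → Set
  Star i = Σ (Node n k) λ c → StarWithCenter i c

  record ReducedCliqueStar : Set where
    field
      tree          : IsTree
      leaves        : ∀ x → deg (inj₁ x) ≤ 1
      internalDeg   : ∀ i → 3 ≤ deg (inj₂ i)
      cliqueOrStar  : ∀ i → Clique i ⊎ Star i
      noCliqueClique : ∀ i j → TE (inj₂ i) (inj₂ j) → Clique i → Clique j → ⊥
      -- no tree edge {i,j} joining the center of star-node i
      -- to an extremity of star-node j
      noCenterExtr  : ∀ i j → TE (inj₂ i) (inj₂ j) →
                      StarWithCenter i (inj₂ j) →
                      ∀ c → StarWithCenter j c → c ≡ inj₂ i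

  -- Auxiliary graph: vertices are leaves and marker vertices (i , a)

  AuxV : Set
  AuxV = Fin n ⊎ (Fin k × Node n k)

  -- the end of tree edge {v,w} on the side of v
  endAt : Node n k → Node n k → AuxV
  endAt (inj₁ x) w = inj₁ x
  endAt (inj₂ i) w = inj₂ (i , w)

  data AuxAdj : AuxV → AuxV → Set where
    interior : ∀ i a b → IsMarker i a → IsMarker i b → T (lab i a b) →
               AuxAdj (inj₂ (i , a)) (inj₂ (i , b))
    treeEdge : ∀ v w → TE v w → AuxAdj (endAt v w) (endAt w v)

  isMarkOf : Fin k → AuxV → Bool
  isMarkOf i (inj₁ _)       = false
  isMarkOf i (inj₂ (j , _)) = does (i ≟F j)

  -- number of interior edges of G_i used by the path p ∷ qs
  -- (consecutive vertices both markers of i form an interior edge of G_i)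
  intCount : Fin k → AuxV → List AuxV → ℕ
  intCount i p []       = 0
  intCount i p (q ∷ qs) =
    (if isMarkOf i p ∧ isMarkOf i q then 1 else 0) + intCount i q qs

  AltPath : AuxV → AuxV → Set
  AltPath p q = Σ (Path AuxAdj p q) λ π → ∀ i → intCount i p (Path.rest π) ≤ 1

  Accessible : Fin n → Fin n → Set
  Accessible x y = x ≢ y × AltPath (inj₁ x) (inj₁ y)

  NoBigCliqueNode : Set
  NoBigCliqueNode = ∀ i → Clique i → deg (inj₂ i) < 4

  NoAltPathBetweenCliques : Set
  NoAltPathBetweenCliques =
    ∀ i j a b → i ≢ j → Clique i → Clique j → IsMarker i a → IsMarker j b →
      ¬ AltPath (inj₂ (i , a)) (inj₂ (j , b))

IsAccessibilityGraphOf : ∀ {n k} → Graph n → GLT n k → Set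
IsAccessibilityGraphOf G t = ∀ x y → Adj G x y ⇔ Accessible t x y

-- An alternated path of the split tree T is the same thing as a walk in T that turns, at
-- every internal node, along an edge of that node's label; such walks are paths of T.  So two
-- leaves are adjacent in G exactly when the T-path between them turns along label edges.
-- From a marker of a node, such a walk can be prolonged until it reaches a leaf: at a clique
-- node through any other marker, at a star node through the centre, or from the centre
-- through any extremity.  Hence a clique node with four markers, or an alternated path between
-- two clique nodes, gives four pairwise adjacent leaves.  Conversely, let x₁, …, x₄ induce a K₄.
-- For i ≠ j in {2, 3, 4} the paths from x₁ to xᵢ and to xⱼ part at a node m at which the path
-- from xᵢ to xⱼ also turns, so the three turns at m form a triangle in its label and m is a
-- clique node.  Either two of these three branch nodes differ, which gives an alternated path
-- between clique nodes, or they are one clique node with four distinct markers.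
module Submission where

open import Data.Bool using (Bool; true; false; T; _∧_; _∨_; if_then_else_)
open import Data.Bool.Properties using (T?; ∧-idem)
open import Data.Empty using (⊥; ⊥-elim)
open import Data.Fin using (Fin; zero; suc; splitAt; join; _↑ˡ_; _↑ʳ_)
open import Data.Fin.Patterns using (0F; 1F; 2F; 3F)
open import Data.Fin.Properties using (any?; splitAt-↑ˡ; splitAt-↑ʳ; splitAt-join; join-splitAt)
  renaming (_≟_ to _≟F_)
open import Data.List using (List; []; _∷_; _++_; _∷ʳ_; length; map; reverse)
open import Data.List.Properties
  using (++-assoc; unfold-reverse; reverse-++; length-map; ∷-injective; ∷-injectiveʳ; ++-conicalʳ; ∷ʳ-++;
         ++-cancelʳ; ∷ʳ-injective)
open import Data.List.Membership.Propositional using (_∈_; _∉_)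
open import Data.List.Membership.Propositional.Properties using (∈-map⁺; ∈-map⁻; ∈-∃++)
open import Data.List.Relation.Binary.Permutation.Setoid using (↭-sym)
open import Data.List.Relation.Binary.Permutation.Setoid.Properties using (Unique-resp-↭; ↭-reverse)
open import Data.List.Relation.Unary.All using ([]; _∷_)
import Data.List.Relation.Unary.All as All
import Data.List.Relation.Unary.All.Properties as AllP
open import Data.List.Relation.Unary.Any using (here; there)
import Data.List.Relation.Unary.Any.Properties as AnyP
open import Data.List.Relation.Unary.Linked using (Linked; []; [-]; _∷_)
open import Data.List.Relation.Unary.Unique.Propositional using (Unique; []; _∷_)
import Data.List.Relation.Unary.Unique.Propositional.Properties as Unique
open import Data.Nat using (ℕ; zero; suc; _+_; _≤_; _<_; z≤n; s≤s)
open import Data.Nat.Properties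
  using (≤-refl; ≤-trans; ≤-reflexive; +-mono-≤; +-assoc; <-irrefl; <-≤-trans; m≤n+m; m≤m+n; m<m+n; +-suc;
         _≤?_; ≰⇒>; module ≤-Reasoning)
open import Data.Nat.Solver using (module +-*-Solver)
open import Data.Product using (∃; ∃₂; _×_; _,_; proj₁; proj₂)
open import Data.Sum using (_⊎_; inj₁; inj₂; [_,_]′)
open import Data.Sum.Properties using (≡-dec; inj₁-injective; inj₂-injective)
open import Data.Unit using (⊤; tt)
open import Data.Vec.Functional using () renaming (_∷_ to _∷ᶠ_)
open import Function using (_∘_)
open import Function.Bundles using (_⇔_; Equivalence; mk⇔)
open import Relation.Binary.Definitions using (DecidableEquality)
open import Relation.Binary.PropositionalEquality
  using (_≡_; _≢_; refl; sym; trans; cong; cong₂; subst; subst₂; setoid; module ≡-Reasoning)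
open import Relation.Nullary using (Dec; yes; no; does; ¬_; contradiction)
open import Relation.Nullary.Decidable using (_×-dec_; ¬?; dec-true)

open import Defs

open +-*-Solver using (solve; _:+_; _:=_)

module _ {A : Set} where

  lastOf-++ : ∀ (x : A) xs y ys → lastOf x (xs ++ y ∷ ys) ≡ lastOf y ys
  lastOf-++ x []       y ys = refl
  lastOf-++ x (z ∷ xs) y ys = lastOf-++ z xs y ys

  lastOf-∈ : ∀ (x : A) xs → lastOf x xs ∈ x ∷ xs
  lastOf-∈ x []       = here refl
  lastOf-∈ x (y ∷ xs) = there (lastOf-∈ y xs)

  ∷∷-lastTwo : ∀ (x : A) y ys → ∃₂ λ zs z → x ∷ y ∷ ys ≡ zs ++ z ∷ lastOf y ys ∷ []
  ∷∷-lastTwo x y []       = [] , x , refl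
  ∷∷-lastTwo x y (z ∷ ys) with zs , w , eq ← ∷∷-lastTwo y z ys = x ∷ zs , w , cong (x ∷_) eq

  ++-lastTwo : ∀ {xs} P (p m : A) R → xs ≡ P ++ p ∷ m ∷ [] → xs ++ R ≡ (P ∷ʳ p) ++ m ∷ R
  ++-lastTwo P p m R refl = trans (++-assoc P (p ∷ m ∷ []) R) (sym (∷ʳ-++ P p (m ∷ R)))

  reverse-++-∷ : ∀ (x : A) xs ys → ∃ λ zs → reverse xs ++ x ∷ ys ≡ lastOf x xs ∷ zs ++ ys
  reverse-++-∷ x []       ys = [] , refl
  reverse-++-∷ x (y ∷ xs) ys with zs , eq ← reverse-++-∷ y xs (x ∷ ys) =
    zs ∷ʳ x , (begin
      reverse (y ∷ xs) ++ x ∷ ys    ≡⟨ cong (_++ x ∷ ys) (unfold-reverse y xs) ⟩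
      (reverse xs ∷ʳ y) ++ x ∷ ys   ≡⟨ ∷ʳ-++ (reverse xs) y (x ∷ ys) ⟩
      reverse xs ++ y ∷ x ∷ ys      ≡⟨ eq ⟩
      lastOf y xs ∷ zs ++ x ∷ ys    ≡⟨ cong (lastOf y xs ∷_) (∷ʳ-++ zs x ys) ⟨
      lastOf y xs ∷ (zs ∷ʳ x) ++ ys ∎)
    where open ≡-Reasoning

  heads-agree : ∀ {a b : A} {as bs} Q {w R R′} → a ∷ as ≡ Q ++ w ∷ R → b ∷ bs ≡ Q ++ w ∷ R′ → a ≡ b
  heads-agree []      refl refl = refl
  heads-agree (_ ∷ _) refl refl = refl

  Linked-join : ∀ {R : A → A → Set} xs {m ys} → Linked R (xs ++ m ∷ []) → Linked R (m ∷ ys) → Linked R (xs ++ m ∷ ys)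
  Linked-join []           _          l₂ = l₂
  Linked-join (x ∷ [])     (r ∷ _)    l₂ = r ∷ l₂
  Linked-join (x ∷ y ∷ xs) (r ∷ l₁)   l₂ = r ∷ Linked-join (y ∷ xs) l₁ l₂

  Unique-++⁻ˡ : ∀ xs {ys : List A} → Unique (xs ++ ys) → Unique xs
  Unique-++⁻ˡ []       _        = []
  Unique-++⁻ˡ (x ∷ xs) (x∉ ∷ u) = AllP.++⁻ˡ xs x∉ ∷ Unique-++⁻ˡ xs u

  Unique-++⁻ʳ : ∀ xs {ys : List A} → Unique (xs ++ ys) → Unique ys
  Unique-++⁻ʳ []       u       = u
  Unique-++⁻ʳ (x ∷ xs) (_ ∷ u) = Unique-++⁻ʳ xs u

  Unique-reverse : ∀ {xs : List A} → Unique xs → Unique (reverse xs)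
  Unique-reverse {xs} = Unique-resp-↭ (setoid A) (↭-sym (setoid A) (↭-reverse (setoid A) xs))

  Unique-≢ : ∀ xs {a b : A} ys {zs} → Unique (xs ++ a ∷ ys ++ b ∷ zs) → a ≢ b
  Unique-≢ []       ys (a∉ ∷ _) refl with a≢a ∷ _ ← AllP.++⁻ʳ ys a∉ = a≢a refl
  Unique-≢ (x ∷ xs) ys (_ ∷ u)       = Unique-≢ xs ys u

  data SplitOrder (xs : List A) (x : A) (ys : List A) (xs′ : List A) (x′ : A) (ys′ : List A) : Set where
    same   : xs ≡ xs′ → x ≡ x′ → ys ≡ ys′ → SplitOrder xs x ys xs′ x′ ys′
    before : ∀ zs → xs′ ≡ xs ++ x ∷ zs → ys ≡ zs ++ x′ ∷ ys′ → SplitOrder xs x ys xs′ x′ ys′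
    after  : ∀ zs → xs ≡ xs′ ++ x′ ∷ zs → ys′ ≡ zs ++ x ∷ ys → SplitOrder xs x ys xs′ x′ ys′

  compareSplits : ∀ xs x ys xs′ x′ ys′ → xs ++ x ∷ ys ≡ xs′ ++ x′ ∷ ys′ → SplitOrder xs x ys xs′ x′ ys′
  compareSplits []       x ys []        x′ ys′ refl = same refl refl refl
  compareSplits []       x ys (_ ∷ xs′) x′ ys′ refl = before xs′ refl refl
  compareSplits (_ ∷ xs) x ys []        x′ ys′ refl = after xs refl refl
  compareSplits (y ∷ xs) x ys (y′ ∷ xs′) x′ ys′ eq with refl , eq′ ← ∷-injective eq
    with compareSplits xs x ys xs′ x′ ys′ eq′
  ... | same p q r     = same (cong (y ∷_) p) q r
  ... | before zs p q  = before zs (cong (y ∷_) p) q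
  ... | after zs p q   = after zs (cong (y ∷_) p) q

  data Divergence (xs ys : List A) : Set where
    equal   : xs ≡ ys → Divergence xs ys
    prefixˡ : ∀ z zs → ys ≡ xs ++ z ∷ zs → Divergence xs ys
    prefixʳ : ∀ z zs → xs ≡ ys ++ z ∷ zs → Divergence xs ys
    fork    : ∀ zs a b as bs → a ≢ b → xs ≡ zs ++ a ∷ as → ys ≡ zs ++ b ∷ bs → Divergence xs ys

  diverge : DecidableEquality A → ∀ xs ys → Divergence xs ys
  diverge _≟_ []       []       = equal refl
  diverge _≟_ []       (y ∷ ys) = prefixˡ y ys refl
  diverge _≟_ (x ∷ xs) []       = prefixʳ x xs refl
  diverge _≟_ (x ∷ xs) (y ∷ ys) with x ≟ y
  ... | no x≢y  = fork [] x y xs ys x≢y refl refl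
  ... | yes refl with diverge _≟_ xs ys
  ...   | equal eq                   = equal (cong (x ∷_) eq)
  ...   | prefixˡ z zs eq            = prefixˡ z zs (cong (x ∷_) eq)
  ...   | prefixʳ z zs eq            = prefixʳ z zs (cong (x ∷_) eq)
  ...   | fork zs a b as bs a≢b p q = fork (x ∷ zs) a b as bs a≢b (cong (x ∷_) p) (cong (x ∷_) q)

indicator : Bool → ℕ
indicator b = if b then 1 else 0

indicator-mono : ∀ {a b} → (T a → T b) → indicator a ≤ indicator b
indicator-mono {false}         _   = z≤n
indicator-mono {true}  {true}  _   = ≤-refl
indicator-mono {true}  {false} a⇒b = ⊥-elim (a⇒b tt)

indicator-∨ : ∀ a b → indicator (a ∨ b) ≤ indicator a + indicator b
indicator-∨ false b     = ≤-refl
indicator-∨ true  false = ≤-refl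
indicator-∨ true  true  = s≤s z≤n

indicator-∨-disjoint : ∀ a b → (T a → T b → ⊥) → indicator a + indicator b ≤ indicator (a ∨ b)
indicator-∨-disjoint false b     _ = ≤-refl
indicator-∨-disjoint true  false _ = ≤-refl
indicator-∨-disjoint true  true  ¬ab = ⊥-elim (¬ab tt tt)

countFin-cong : ∀ {m} {f g : Fin m → Bool} → (∀ x → f x ≡ g x) → countFin f ≡ countFin g
countFin-cong {zero}  _   = refl
countFin-cong {suc m} f≗g = cong₂ (λ b c → indicator b + c) (f≗g zero) (countFin-cong (f≗g ∘ suc))

countFin-mono : ∀ {m} {f g : Fin m → Bool} → (∀ x → T (f x) → T (g x)) → countFin f ≤ countFin g
countFin-mono {zero}  _   = z≤n
countFin-mono {suc m} f⇒g = +-mono-≤ (indicator-mono (f⇒g zero)) (countFin-mono (f⇒g ∘ suc))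

private
  interchange : ∀ a b c d → (a + b) + (c + d) ≡ (a + c) + (b + d)
  interchange = solve 4 (λ a b c d → (a :+ b) :+ (c :+ d) := (a :+ c) :+ (b :+ d)) refl

countFin-∨ : ∀ {m} (f g : Fin m → Bool) → countFin (λ x → f x ∨ g x) ≤ countFin f + countFin g
countFin-∨ {zero}  f g = z≤n
countFin-∨ {suc m} f g = begin
  indicator (f zero ∨ g zero) + countFin (λ x → f (suc x) ∨ g (suc x))
    ≤⟨ +-mono-≤ (indicator-∨ (f zero) (g zero)) (countFin-∨ (f ∘ suc) (g ∘ suc)) ⟩
  (indicator (f zero) + indicator (g zero)) + (countFin (f ∘ suc) + countFin (g ∘ suc))
    ≡⟨ interchange (indicator (f zero)) _ _ _ ⟩
  countFin f + countFin g ∎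
  where open ≤-Reasoning

countFin-∨-disjoint : ∀ {m} (f g : Fin m → Bool) → (∀ x → T (f x) → T (g x) → ⊥) →
                      countFin f + countFin g ≤ countFin (λ x → f x ∨ g x)
countFin-∨-disjoint {zero}  f g _ = z≤n
countFin-∨-disjoint {suc m} f g f#g = begin
  countFin f + countFin g
    ≡⟨ interchange (indicator (f zero)) _ _ _ ⟩
  (indicator (f zero) + indicator (g zero)) + (countFin (f ∘ suc) + countFin (g ∘ suc))
    ≤⟨ +-mono-≤ (indicator-∨-disjoint (f zero) (g zero) (f#g zero))
                (countFin-∨-disjoint (f ∘ suc) (g ∘ suc) (f#g ∘ suc)) ⟩
  indicator (f zero ∨ g zero) + countFin (λ x → f (suc x) ∨ g (suc x)) ∎
  where open ≤-Reasoning

countFin-false : ∀ {m} → countFin {m} (λ _ → false) ≡ 0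
countFin-false {zero}  = refl
countFin-false {suc m} = countFin-false {m}

countFin-true : ∀ {m} → countFin {m} (λ _ → true) ≡ m
countFin-true {zero}  = refl
countFin-true {suc m} = cong suc (countFin-true {m})

countFin-≟ : ∀ {m} (a : Fin m) → countFin (λ x → does (x ≟F a)) ≡ 1
countFin-≟ {suc m} zero    = cong suc (countFin-false {m})
countFin-≟ {suc m} (suc a) = countFin-≟ a

T-does⇒ : ∀ {P : Set} (d : Dec P) → T (does d) → P
T-does⇒ (yes p) _ = p

module _ {m : ℕ} where
  open import Data.List.Membership.DecPropositional (_≟F_ {m}) using (_∈?_)

  countFin-∈?-≤ : ∀ (L : List (Fin m)) → countFin (λ x → does (x ∈? L)) ≤ length L
  countFin-∈?-≤ []      = ≤-reflexive (countFin-false {m})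
  countFin-∈?-≤ (a ∷ L) = ≤-trans (countFin-∨ (λ x → does (x ≟F a)) (λ x → does (x ∈? L)))
                                  (+-mono-≤ (≤-reflexive (countFin-≟ a)) (countFin-∈?-≤ L))

  Unique⇒length≤countFin-∈? : ∀ {L : List (Fin m)} → Unique L → length L ≤ countFin (λ x → does (x ∈? L))
  Unique⇒length≤countFin-∈? []               = z≤n
  Unique⇒length≤countFin-∈? {a ∷ L} (a∉ ∷ u) = ≤-trans
    (subst (λ c → suc (length L) ≤ c + countFin (λ x → does (x ∈? L)))
           (sym (countFin-≟ a)) (s≤s (Unique⇒length≤countFin-∈? u)))
    (countFin-∨-disjoint (λ x → does (x ≟F a)) (λ x → does (x ∈? L)) a∉L)
    where
    a∉L : ∀ x → T (does (x ≟F a)) → T (does (x ∈? L)) → ⊥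
    a∉L x x≡a x∈L = All.lookup a∉ (T-does⇒ (x ∈? L) x∈L) (sym (T-does⇒ (x ≟F a) x≡a))

  Unique⇒length≤countFin : ∀ (f : Fin m → Bool) {L} → Unique L → (∀ {x} → x ∈ L → T (f x)) →
                           length L ≤ countFin f
  Unique⇒length≤countFin f {L} u L⊆f =
    ≤-trans (Unique⇒length≤countFin-∈? u) (countFin-mono (λ x x∈L → L⊆f (T-does⇒ (x ∈? L) x∈L)))

  length<countFin⇒∃∉ : ∀ (f : Fin m → Bool) L → length L < countFin f → ∃ λ x → T (f x) × x ∉ L
  length<countFin⇒∃∉ f L L<f with any? (λ x → T? (f x) ×-dec ¬? (x ∈? L))
  ... | yes found = found
  ... | no none   = ⊥-elim (<-irrefl refl (<-≤-trans L<f (≤-trans (countFin-mono f⇒∈L) (countFin-∈?-≤ L))))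
    where
    f⇒∈L : ∀ x → T (f x) → T (does (x ∈? L))
    f⇒∈L x fx with x ∈? L
    ... | yes _  = tt
    ... | no x∉L = ⊥-elim (none (x , fx , x∉L))

countSum : ∀ {n k} → (Fin n ⊎ Fin k → Bool) → ℕ
countSum f = countFin (λ x → f (inj₁ x)) + countFin (λ i → f (inj₂ i))

countFin-+ : ∀ n {k} (g : Fin (n + k) → Bool) →
             countFin g ≡ countFin (λ i → g (i ↑ˡ k)) + countFin (λ i → g (n ↑ʳ i))
countFin-+ zero    g = refl
countFin-+ (suc n) g = trans (cong (indicator (g zero) +_) (countFin-+ n (g ∘ suc)))
                             (sym (+-assoc (indicator (g zero)) _ _))

module _ {n k : ℕ} where

  countSum≡countFin∘splitAt : ∀ (f : Fin n ⊎ Fin k → Bool) → countSum f ≡ countFin (f ∘ splitAt n)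
  countSum≡countFin∘splitAt f = sym (trans (countFin-+ n (f ∘ splitAt n))
    (cong₂ _+_ (countFin-cong (λ i → cong f (splitAt-↑ˡ n i k)))
               (countFin-cong (λ i → cong f (splitAt-↑ʳ n k i)))))

  private
    join-injective : ∀ {v w} → join n k v ≡ join n k w → v ≡ w
    join-injective {v} {w} eq = trans (sym (splitAt-join n k v)) (trans (cong (splitAt n) eq) (splitAt-join n k w))

  Unique⇒length≤countSum : ∀ (f : Fin n ⊎ Fin k → Bool) {L} → Unique L → (∀ {v} → v ∈ L → T (f v)) →
                           length L ≤ countSum f
  Unique⇒length≤countSum f {L} u L⊆f = subst₂ _≤_ (length-map (join n k) L) (sym (countSum≡countFin∘splitAt f))
    (Unique⇒length≤countFin (f ∘ splitAt n) (Unique.map⁺ join-injective u) joinL⊆f)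
    where
    joinL⊆f : ∀ {j} → j ∈ map (join n k) L → T (f (splitAt n j))
    joinL⊆f j∈ with v , v∈L , refl ← ∈-map⁻ (join n k) j∈ = subst (T ∘ f) (sym (splitAt-join n k v)) (L⊆f v∈L)

  length<countSum⇒∃∉ : ∀ (f : Fin n ⊎ Fin k → Bool) L → length L < countSum f → ∃ λ v → T (f v) × v ∉ L
  length<countSum⇒∃∉ f L L<f
    with j , fj , j∉ ← length<countFin⇒∃∉ (f ∘ splitAt n) (map (join n k) L)
                         (subst₂ _<_ (sym (length-map (join n k) L)) (countSum≡countFin∘splitAt f) L<f)
    = splitAt n j , fj , λ v∈L → j∉ (subst (_∈ map (join n k) L) (join-splitAt n k j) (∈-map⁺ (join n k) v∈L))

module _ {n : ℕ} (G : Graph n) where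

  Adj-sym : ∀ {x y} → Adj G x y → Adj G y x
  Adj-sym {x} {y} = subst T (Graph.sym G x y)

  Adj⇒≢ : ∀ {x y} → Adj G x y → x ≢ y
  Adj⇒≢ {x} xx refl = subst T (Graph.irrefl G x) xx

  pairwiseAdjacent⇒HasLargeClique : ∀ {m} (v : Fin m → Fin n) → 4 ≤ m →
                                    (∀ {p q} → p ≢ q → Adj G (v p) (v q)) → HasLargeClique G
  pairwiseAdjacent⇒HasLargeClique {m} v 4≤m adj = m , 4≤m , v , injective , λ _ _ → adj
    where
    injective : ∀ {p q} → v p ≡ v q → p ≡ q
    injective {p} {q} vp≡vq with p ≟F q
    ... | yes p≡q = p≡q
    ... | no  p≢q = ⊥-elim (Adj⇒≢ (adj p≢q) vp≡vq)

module SplitTree {n k : ℕ} (t : GLT n k) (RC : ReducedCliqueStar t) where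
  open GLT t
  open ReducedCliqueStar RC

  Nd : Set
  Nd = Node n k

  _≟N_ : DecidableEquality Nd
  _≟N_ = ≡-dec _≟F_ _≟F_

  TE-sym : ∀ {u v} → TE t u v → TE t v u
  TE-sym {u} {v} = subst T (E-sym u v)

  TE⇒≢ : ∀ {u v} → TE t u v → u ≢ v
  TE⇒≢ {u} uu refl = subst T (E-irrefl u) uu

  length≤deg : ∀ v {L} → Unique L → (∀ {w} → w ∈ L → TE t v w) → length L ≤ deg t v
  length≤deg v = Unique⇒length≤countSum (E v)

  length<deg⇒∃∉ : ∀ v L → length L < deg t v → ∃ λ w → TE t v w × w ∉ L
  length<deg⇒∃∉ v = length<countSum⇒∃∉ (E v)

  Unique⇒length≤n+k : ∀ {L : List Nd} → Unique L → length L ≤ n + k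
  Unique⇒length≤n+k {L} u = subst (length L ≤_) (cong₂ _+_ (countFin-true {n}) (countFin-true {k}))
                                    (Unique⇒length≤countSum (λ _ → true) u (λ _ → tt))

  leaf-neighbour-unique : ∀ {x a b} → TE t (inj₁ x) a → TE t (inj₁ x) b → a ≡ b
  leaf-neighbour-unique {x} {a} {b} xa xb with a ≟N b
  ... | yes a≡b = a≡b
  ... | no  a≢b = ⊥-elim (2≰1 (≤-trans (length≤deg (inj₁ x) ab-unique ab-neighbours) (leaves x)))
    where
    2≰1 : ¬ 2 ≤ 1
    2≰1 (s≤s ())
    ab-unique : Unique (a ∷ b ∷ [])
    ab-unique = (a≢b ∷ []) ∷ [] ∷ []
    ab-neighbours : ∀ {w} → w ∈ a ∷ b ∷ [] → TE t (inj₁ x) w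
    ab-neighbours (here refl)         = xa
    ab-neighbours (there (here refl)) = xb

  tree-path-unique : ∀ {x r r′} → Linked (TE t) (x ∷ r) → Unique (x ∷ r) →
                     Linked (TE t) (x ∷ r′) → Unique (x ∷ r′) → lastOf x r ≡ lastOf x r′ → r ≡ r′
  tree-path-unique l u l′ u′ eq = proj₂ tree _ _ (path _ l eq u) (path _ l′ refl u′)

  Turn : Nd → Nd → Nd → Set
  Turn u (inj₁ _) w = ⊥
  Turn u (inj₂ i) w = T (lab i u w)

  Turn-sym : ∀ u v w → Turn u v w → Turn w v u
  Turn-sym u (inj₂ i) w = subst T (lab-sym i u w)

  Turn-irrefl : ∀ u v → ¬ Turn u v u
  Turn-irrefl u (inj₂ i) = subst T (lab-irrefl i u)

  -- The walks of T that correspond to alternated paths.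
  AltWalk : List Nd → Set
  AltWalk []              = ⊤
  AltWalk (u ∷ [])        = ⊤
  AltWalk (u ∷ v ∷ [])    = TE t u v
  AltWalk (u ∷ v ∷ w ∷ r) = TE t u v × Turn u v w × AltWalk (v ∷ w ∷ r)

  AltWalk⇒Linked : ∀ L → AltWalk L → Linked (TE t) L
  AltWalk⇒Linked []              _              = []
  AltWalk⇒Linked (u ∷ [])        _              = [-]
  AltWalk⇒Linked (u ∷ v ∷ [])    uv             = uv ∷ [-]
  AltWalk⇒Linked (u ∷ v ∷ w ∷ r) (uv , _ , alt) = uv ∷ AltWalk⇒Linked (v ∷ w ∷ r) alt

  AltWalk-tail : ∀ u L → AltWalk (u ∷ L) → AltWalk L
  AltWalk-tail u []          _           = tt
  AltWalk-tail u (v ∷ [])    _           = tt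
  AltWalk-tail u (v ∷ w ∷ r) (_ , _ , alt) = alt

  AltWalk-++⁻ʳ : ∀ P {Q} → AltWalk (P ++ Q) → AltWalk Q
  AltWalk-++⁻ʳ []      alt = alt
  AltWalk-++⁻ʳ (u ∷ P) alt = AltWalk-++⁻ʳ P (AltWalk-tail u (P ++ _) alt)

  AltWalk-++⁻ˡ : ∀ P {Q} → AltWalk (P ++ Q) → AltWalk P
  AltWalk-++⁻ˡ []                    _              = tt
  AltWalk-++⁻ˡ (u ∷ [])              _              = tt
  AltWalk-++⁻ˡ (u ∷ v ∷ [])    {[]}    uv             = uv
  AltWalk-++⁻ˡ (u ∷ v ∷ [])    {_ ∷ _} (uv , _ , _)   = uv
  AltWalk-++⁻ˡ (u ∷ v ∷ w ∷ P)       (uv , uvw , alt) = uv , uvw , AltWalk-++⁻ˡ (v ∷ w ∷ P) alt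

  AltWalk-turn : ∀ P {a m b R} → AltWalk (P ++ a ∷ m ∷ b ∷ R) → Turn a m b
  AltWalk-turn P alt with _ , turn , _ ← AltWalk-++⁻ʳ P alt = turn

  AltWalk-edge : ∀ P {a b R} → AltWalk (P ++ a ∷ b ∷ R) → TE t a b
  AltWalk-edge P {R = R} alt = edge R (AltWalk-++⁻ʳ P alt)
    where
    edge : ∀ {a b} R → AltWalk (a ∷ b ∷ R) → TE t a b
    edge []      ab          = ab
    edge (_ ∷ _) (ab , _ , _) = ab

  AltWalk-join : ∀ P {a m b R} → AltWalk (P ++ a ∷ m ∷ []) → AltWalk (m ∷ b ∷ R) → Turn a m b →
                 AltWalk (P ++ a ∷ m ∷ b ∷ R)
  AltWalk-join []                      am               mR amb = am , amb , mR
  AltWalk-join (u ∷ [])        {R = R} (ua , uam , am)  mR amb = ua , uam , AltWalk-join [] {R = R} am mR amb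
  AltWalk-join (u ∷ v ∷ [])    {R = R} (uv , uva , alt) mR amb =
    uv , uva , AltWalk-join (v ∷ []) {R = R} alt mR amb
  AltWalk-join (u ∷ v ∷ w ∷ P) {R = R} (uv , uvw , alt) mR amb =
    uv , uvw , AltWalk-join (v ∷ w ∷ P) {R = R} alt mR amb

  AltWalk-reverse : ∀ L → AltWalk L → AltWalk (reverse L)
  AltWalk-reverse []              _ = tt
  AltWalk-reverse (u ∷ [])        _ = tt
  AltWalk-reverse (u ∷ v ∷ [])    uv = TE-sym uv
  AltWalk-reverse (u ∷ v ∷ w ∷ r) (uv , uvw , alt) =
    subst AltWalk (sym (reverse-++ (u ∷ v ∷ w ∷ []) r))
      (AltWalk-join (reverse r)
        (subst AltWalk (reverse-++ (v ∷ w ∷ []) r) (AltWalk-reverse (v ∷ w ∷ r) alt))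
        (TE-sym uv) (Turn-sym u v w uvw))

  -- A return to u would give a second tree path from v to u besides the edge v u.
  AltWalk-no-return : ∀ {u v} w A B → TE t u v → AltWalk (v ∷ w ∷ A ++ u ∷ B) →
                      Unique (v ∷ w ∷ A ++ u ∷ B) → ⊥
  AltWalk-no-return {u} {v} w A B uv alt unique =
    contradiction (++-conicalʳ A (u ∷ []) (∷-injectiveʳ walk≡edge)) λ ()
    where
    split : v ∷ w ∷ A ++ u ∷ B ≡ (v ∷ w ∷ A ++ u ∷ []) ++ B
    split = cong (λ xs → v ∷ w ∷ xs) (sym (++-assoc A (u ∷ []) B))
    walk≡edge : w ∷ A ++ u ∷ [] ≡ u ∷ []
    walk≡edge = tree-path-unique
      (AltWalk⇒Linked _ (AltWalk-++⁻ˡ (v ∷ w ∷ A ++ u ∷ []) (subst AltWalk split alt)))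
      (Unique-++⁻ˡ (v ∷ w ∷ A ++ u ∷ []) (subst Unique split unique))
      (TE-sym uv ∷ [-]) ((TE⇒≢ (TE-sym uv) ∷ []) ∷ [] ∷ [])
      (lastOf-++ v (w ∷ A) u [])

  AltWalk-∷-∉ : ∀ {u v w r} → TE t u v → Turn u v w → AltWalk (v ∷ w ∷ r) → Unique (v ∷ w ∷ r) →
                u ∉ v ∷ w ∷ r
  AltWalk-∷-∉ uv uvw alt unique (here refl)         = TE⇒≢ uv refl
  AltWalk-∷-∉ {u} {v} uv uvw alt unique (there (here refl)) = Turn-irrefl u v uvw
  AltWalk-∷-∉ uv uvw alt unique (there (there u∈r)) with A , B , refl ← ∈-∃++ u∈r =
    AltWalk-no-return _ A B uv alt unique

  AltWalk⇒Unique : ∀ L → AltWalk L → Unique L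
  AltWalk⇒Unique []              _  = []
  AltWalk⇒Unique (u ∷ [])        _  = [] ∷ []
  AltWalk⇒Unique (u ∷ v ∷ [])    uv = (TE⇒≢ uv ∷ []) ∷ [] ∷ []
  AltWalk⇒Unique (u ∷ v ∷ w ∷ r) (uv , uvw , alt) =
    let unique = AltWalk⇒Unique (v ∷ w ∷ r) alt in AllP.¬Any⇒All¬ _ (AltWalk-∷-∉ uv uvw alt unique) ∷ unique

  nodeOf : AuxV t → Nd
  nodeOf (inj₁ x)       = inj₁ x
  nodeOf (inj₂ (i , _)) = inj₂ i

  nodeOf-endAt : ∀ v w → nodeOf (endAt t v w) ≡ v
  nodeOf-endAt (inj₁ x) w = refl
  nodeOf-endAt (inj₂ i) w = refl

  -- The alternated path of the walk u ∷ v ∷ ws, after its first vertex endAt t u v.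
  auxFrom : Nd → Nd → List Nd → List (AuxV t)
  auxFrom u v []       = endAt t v u ∷ []
  auxFrom u v (w ∷ ws) = endAt t v u ∷ endAt t v w ∷ auxFrom v w ws

  auxFrom-linked : ∀ u v ws → AltWalk (u ∷ v ∷ ws) → Linked (AuxAdj t) (endAt t u v ∷ auxFrom u v ws)
  auxFrom-linked u v        []            uv               = treeEdge u v uv ∷ [-]
  auxFrom-linked u (inj₂ i) (w ∷ [])      (uv , uvw , vw)  =
    treeEdge u (inj₂ i) uv ∷ interior i u w (TE-sym uv) vw uvw ∷ auxFrom-linked (inj₂ i) w [] vw
  auxFrom-linked u (inj₂ i) (w ∷ x ∷ ws) (uv , uvw , alt) =
    treeEdge u (inj₂ i) uv ∷ interior i u w (TE-sym uv) (proj₁ alt) uvw ∷ auxFrom-linked (inj₂ i) w (x ∷ ws) alt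

  auxFrom-nodes : ∀ {z} u v ws → z ∈ auxFrom u v ws → nodeOf z ∈ v ∷ ws
  auxFrom-nodes u v []       (here refl)         = here (nodeOf-endAt v u)
  auxFrom-nodes u v (w ∷ ws) (here refl)         = here (nodeOf-endAt v u)
  auxFrom-nodes u v (w ∷ ws) (there (here refl)) = here (nodeOf-endAt v w)
  auxFrom-nodes u v (w ∷ ws) (there (there z∈))  = there (auxFrom-nodes v w ws z∈)

  ∉⇒endAt∉auxFrom : ∀ {x} y u v ws → x ∉ v ∷ ws → endAt t x y ∉ auxFrom u v ws
  ∉⇒endAt∉auxFrom {x} y u v ws x∉ z∈ = x∉ (subst (_∈ v ∷ ws) (nodeOf-endAt x y) (auxFrom-nodes u v ws z∈))

  Turn⇒endAt≢ : ∀ u v w → Turn u v w → endAt t v u ≢ endAt t v w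
  Turn⇒endAt≢ u (inj₂ i) w uvw refl = Turn-irrefl u (inj₂ i) uvw

  auxFrom-unique : ∀ u v ws → AltWalk (u ∷ v ∷ ws) → Unique (v ∷ ws) → Unique (auxFrom u v ws)
  auxFrom-unique u v []       _                 _              = [] ∷ []
  auxFrom-unique u v (w ∷ ws) (_ , uvw , alt) (v∉ ∷ unique) =
    (Turn⇒endAt≢ u v w uvw ∷ AllP.¬Any⇒All¬ _ (∉⇒endAt∉auxFrom u v w ws v∉′)) ∷
    AllP.¬Any⇒All¬ _ (∉⇒endAt∉auxFrom w v w ws v∉′) ∷ auxFrom-unique v w ws alt unique
    where
    v∉′ : v ∉ w ∷ ws
    v∉′ = AllP.All¬⇒¬Any v∉

  isNode : Fin k → Nd → Bool
  isNode i (inj₁ _) = false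
  isNode i (inj₂ j) = does (i ≟F j)

  isMarkOf-endAt : ∀ i v w → isMarkOf t i (endAt t v w) ≡ isNode i v
  isMarkOf-endAt i (inj₁ x) w = refl
  isMarkOf-endAt i (inj₂ j) w = refl

  isNode⇒≡ : ∀ i v → T (isNode i v) → v ≡ inj₂ i
  isNode⇒≡ i (inj₂ j) i≡j = cong inj₂ (sym (T-does⇒ (i ≟F j) i≡j))

  nodeCount : Fin k → List Nd → ℕ
  nodeCount i []       = 0
  nodeCount i (v ∷ vs) = indicator (isNode i v) + nodeCount i vs

  ∉⇒nodeCount≡0 : ∀ i vs → inj₂ i ∉ vs → nodeCount i vs ≡ 0
  ∉⇒nodeCount≡0 i []       _  = refl
  ∉⇒nodeCount≡0 i (v ∷ vs) i∉ with isNode i v in eq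
  ... | true  = ⊥-elim (i∉ (here (sym (isNode⇒≡ i v (subst T (sym eq) tt)))))
  ... | false = ∉⇒nodeCount≡0 i vs (i∉ ∘ there)

  Unique⇒nodeCount≤1 : ∀ i {vs} → Unique vs → nodeCount i vs ≤ 1
  Unique⇒nodeCount≤1 i {[]}     _          = z≤n
  Unique⇒nodeCount≤1 i {v ∷ vs} (v∉ ∷ unique) with isNode i v in eq
  ... | true  = ≤-reflexive (cong suc (∉⇒nodeCount≡0 i vs
                  (AllP.All¬⇒¬Any v∉ ∘ subst (_∈ vs) (sym (isNode⇒≡ i v (subst T (sym eq) tt))))))
  ... | false = Unique⇒nodeCount≤1 i unique

  indicator-isNode-≢ : ∀ i {u v} → u ≢ v → indicator (isNode i u ∧ isNode i v) ≡ 0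
  indicator-isNode-≢ i {u} {v} u≢v with isNode i u in eu | isNode i v in ev
  ... | true  | true  = ⊥-elim (u≢v (trans (isNode⇒≡ i u (subst T (sym eu) tt))
                                         (sym (isNode⇒≡ i v (subst T (sym ev) tt)))))
  ... | true  | false = refl
  ... | false | _     = refl

  -- Only the consecutive vertices endAt t v u, endAt t v w lie in one label, so each
  -- interior edge used by the path comes from a visit of the walk to a node.
  intCount-auxFrom : ∀ i u v ws → AltWalk (u ∷ v ∷ ws) →
                     intCount t i (endAt t u v) (auxFrom u v ws) ≤ nodeCount i (v ∷ ws)
  intCount-auxFrom i u v [] uv
    rewrite isMarkOf-endAt i u v | isMarkOf-endAt i v u | indicator-isNode-≢ i (TE⇒≢ uv) = z≤n
  intCount-auxFrom i u v (w ∷ ws) (uv , _ , alt)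
    rewrite isMarkOf-endAt i u v | isMarkOf-endAt i v u | isMarkOf-endAt i v w
          | indicator-isNode-≢ i (TE⇒≢ uv) | ∧-idem (isNode i v)
    = +-mono-≤ (≤-refl {indicator (isNode i v)}) (intCount-auxFrom i v w ws alt)

  lastOf-auxFrom : ∀ z u v ws → AltWalk (u ∷ v ∷ ws) →
                   ∃ λ p → TE t (lastOf v ws) p × lastOf z (auxFrom u v ws) ≡ endAt t (lastOf v ws) p
  lastOf-auxFrom z u v []       uv  = u , TE-sym uv , refl
  lastOf-auxFrom z u v (w ∷ ws) alt = lastOf-auxFrom (endAt t v w) v w ws (AltWalk-tail u (v ∷ w ∷ ws) alt)

  AltWalk⇒AltPath : ∀ u v ws → AltWalk (u ∷ v ∷ ws) →
                    ∃ λ p → TE t (lastOf v ws) p × AltPath t (endAt t u v) (endAt t (lastOf v ws) p)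
  AltWalk⇒AltPath u v ws alt with u∉ ∷ unique ← AltWalk⇒Unique (u ∷ v ∷ ws) alt
                               | p , last-p , last≡ ← lastOf-auxFrom (endAt t u v) u v ws alt =
    p , last-p ,
    (path (auxFrom u v ws) (auxFrom-linked u v ws alt) last≡
          (AllP.¬Any⇒All¬ _ (∉⇒endAt∉auxFrom v u v ws (AllP.All¬⇒¬Any u∉)) ∷ auxFrom-unique u v ws alt unique) ,
     λ i → ≤-trans (intCount-auxFrom i u v ws alt) (Unique⇒nodeCount≤1 i unique))

  data AuxEdge (p q : AuxV t) : Set where
    interiorEdge : ∀ i a b → T (lab i a b) → p ≡ inj₂ (i , a) → q ≡ inj₂ (i , b) → AuxEdge p q
    treeEdge     : ∀ v w → TE t v w → p ≡ endAt t v w → q ≡ endAt t w v → AuxEdge p q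

  auxEdge : ∀ {p q} → AuxAdj t p q → AuxEdge p q
  auxEdge (interior i a b _ _ ab) = interiorEdge i a b ab refl refl
  auxEdge (treeEdge v w vw)       = treeEdge v w vw refl refl

  intCount-∷ : ∀ i p q qs → intCount t i q qs ≤ intCount t i p (q ∷ qs)
  intCount-∷ i p q qs = m≤n+m (intCount t i q qs) _

  ¬two-interior-edges : ∀ i a b c zs → ¬ intCount t i (inj₂ (i , a)) (inj₂ (i , b) ∷ inj₂ (i , c) ∷ zs) ≤ 1
  ¬two-interior-edges i a b c zs ≤1 rewrite dec-true (i ≟F i) refl with s≤s () ← ≤1

  interior-step : ∀ {u i z} → endAt t u (inj₂ i) ≢ z → AuxAdj t (inj₂ (i , u)) z →
                  ∃ λ b → T (lab i u b) × z ≡ inj₂ (i , b)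
  interior-step u≢z e with auxEdge e
  ... | interiorEdge _ _ b ub refl refl = b , ub , refl
  ... | treeEdge (inj₁ _) _ _ () _
  ... | treeEdge (inj₂ _) _ _ refl refl = ⊥-elim (u≢z refl)

  decodeFrom : ∀ u v zs → TE t u v → Linked (AuxAdj t) (endAt t u v ∷ endAt t v u ∷ zs) →
               Unique (endAt t u v ∷ endAt t v u ∷ zs) →
               (∀ i → intCount t i (endAt t u v) (endAt t v u ∷ zs) ≤ 1) →
               ∃ λ ws → AltWalk (u ∷ v ∷ ws) × lastOf v ws ≡ nodeOf (lastOf (endAt t v u) zs)
  decodeFrom u v        []            uv _ _ _ = [] , uv , sym (nodeOf-endAt v u)
  decodeFrom u (inj₁ x) (z ∷ zs)      uv (_ ∷ e ∷ _) ((_ ∷ u≢z ∷ _) ∷ _) _ with auxEdge e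
  ... | interiorEdge _ _ _ _ () _
  ... | treeEdge (inj₂ _) _ _ () _
  ... | treeEdge (inj₁ _) w xw refl refl =
          ⊥-elim (u≢z (cong (λ y → endAt t y (inj₁ x)) (leaf-neighbour-unique (TE-sym uv) xw)))
  decodeFrom u (inj₂ i) (z ∷ [])      uv (_ ∷ e ∷ _) ((_ ∷ u≢z ∷ _) ∷ _) _
    with b , ub , refl ← interior-step u≢z e = [] , uv , refl
  decodeFrom u (inj₂ i) (z ∷ z′ ∷ zs) uv (_ ∷ e ∷ e′ ∷ l) un@((_ ∷ u≢z ∷ _) ∷ _) ic
    with b , ub , refl ← interior-step u≢z e
    with auxEdge e′
  ... | interiorEdge _ _ c _ refl refl =
          ⊥-elim (¬two-interior-edges i u b c zs
            (≤-trans (intCount-∷ i (endAt t u (inj₂ i)) (inj₂ (i , u)) (inj₂ (i , b) ∷ inj₂ (i , c) ∷ zs)) (ic i)))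
  ... | treeEdge (inj₁ _) _ _ () _
  ... | treeEdge (inj₂ _) _ ib refl refl
          with ws , alt , last ← decodeFrom (inj₂ i) b zs ib (e′ ∷ l) (Unique-++⁻ʳ (_ ∷ _ ∷ []) un)
                 (λ j → ≤-trans (intCount-∷ j (inj₂ (i , u)) (inj₂ (i , b)) (endAt t b (inj₂ i) ∷ zs))
                        (≤-trans (intCount-∷ j (endAt t u (inj₂ i)) (inj₂ (i , u))
                                              (inj₂ (i , b) ∷ endAt t b (inj₂ i) ∷ zs))
                                 (ic j)))
          = b ∷ ws , (uv , ub , alt) , last

  decodeAfterInterior : ∀ i a b zs → Linked (AuxAdj t) (inj₂ (i , b) ∷ zs) → Unique (inj₂ (i , b) ∷ zs) →
                        (∀ j → intCount t j (inj₂ (i , a)) (inj₂ (i , b) ∷ zs) ≤ 1) →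
                        inj₂ i ≢ nodeOf (lastOf (inj₂ (i , b)) zs) →
                        ∃ λ ws → AltWalk (inj₂ i ∷ ws) × lastOf (inj₂ i) ws ≡ nodeOf (lastOf (inj₂ (i , b)) zs)
  decodeAfterInterior i a b []       _       _  _  i≢i = ⊥-elim (i≢i refl)
  decodeAfterInterior i a b (z ∷ zs) (e ∷ l) un ic _ with auxEdge e
  ... | interiorEdge _ _ c _ refl refl = ⊥-elim (¬two-interior-edges i a b c zs (ic i))
  ... | treeEdge (inj₁ _) _ _ () _
  ... | treeEdge (inj₂ _) w iw refl refl
          with ws , alt , last ← decodeFrom (inj₂ i) w zs iw (e ∷ l) un
                                   (λ j → ≤-trans (intCount-∷ j (inj₂ (i , a)) (inj₂ (i , w)) (z ∷ zs)) (ic j))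
          = w ∷ ws , alt , last

  AltPath⇒AltWalk : ∀ {p q} → AltPath t p q → nodeOf p ≢ nodeOf q →
                    ∃ λ ws → AltWalk (nodeOf p ∷ ws) × lastOf (nodeOf p) ws ≡ nodeOf q
  AltPath⇒AltWalk (path [] _ ends _ , _) p≢q = ⊥-elim (p≢q (cong nodeOf ends))
  AltPath⇒AltWalk (path (z ∷ zs) (e ∷ l) ends un , ic) p≢q with auxEdge e
  ... | treeEdge v w vw refl refl rewrite nodeOf-endAt v w
        with ws , alt , last ← decodeFrom v w zs vw (e ∷ l) un ic
        = w ∷ ws , alt , trans last (cong nodeOf ends)
  ... | interiorEdge i a b _ refl refl
        with ws , alt , last ← decodeAfterInterior i a b zs l (Unique-++⁻ʳ (_ ∷ []) un) ic
                                 (λ eq → p≢q (trans eq (cong nodeOf ends)))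
        = ws , alt , trans last (cong nodeOf ends)

  label-neighbour : ∀ j u → TE t (inj₂ j) u → ∃ λ x → TE t (inj₂ j) x × T (lab j u x)
  label-neighbour j u ju with cliqueOrStar j
  ... | inj₁ clique with x , jx , x∉ ← length<deg⇒∃∉ (inj₂ j) (u ∷ []) (≤-trans (s≤s (s≤s z≤n)) (internalDeg j))
    = x , jx , clique u x ju jx (λ u≡x → x∉ (here (sym u≡x)))
  ... | inj₂ (c , jc , star) with u ≟N c
  ...   | no u≢c = c , jc , Equivalence.from (star u c ju jc u≢c) (inj₂ refl)
  ...   | yes refl with x , jx , x∉ ← length<deg⇒∃∉ (inj₂ j) (u ∷ []) (≤-trans (s≤s (s≤s z≤n)) (internalDeg j))
    = x , jx , Equivalence.from (star u x ju jx (λ u≡x → x∉ (here (sym u≡x)))) (inj₁ refl)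

  -- The walk is grown at its head; it stays simple, so it reaches a leaf within n + k steps.
  escape′ : ∀ fuel w u r → AltWalk (w ∷ u ∷ r) → n + k < fuel + length (w ∷ u ∷ r) →
            ∃₂ λ P y → AltWalk (P ++ w ∷ u ∷ r) × lastOf w (reverse P) ≡ inj₁ y
  escape′ fuel       (inj₁ y) u r alt _    = [] , y , alt , refl
  escape′ zero       (inj₂ j) u r alt long =
    ⊥-elim (<-irrefl refl (<-≤-trans long (Unique⇒length≤n+k (AltWalk⇒Unique (inj₂ j ∷ u ∷ r) alt))))
  escape′ (suc fuel) (inj₂ j) u r alt long
    with x , jx , ux ← label-neighbour j u (AltWalk-edge [] {R = r} alt)
    with P , y , alt′ , last ← escape′ fuel x (inj₂ j) (u ∷ r) (TE-sym jx , Turn-sym u (inj₂ j) x ux , alt)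
                                       (subst (n + k <_) (sym (+-suc fuel _)) long)
    = P ∷ʳ x , y , subst AltWalk (sym (∷ʳ-++ P x _)) alt′ ,
      subst (λ ws → lastOf (inj₂ j) ws ≡ inj₁ y) (sym (reverse-++ P (x ∷ []))) last

  record LeafWalk (u w : Nd) (y : Fin n) : Set where
    constructor leafWalk
    field
      rest : List Nd
      walk : AltWalk (u ∷ w ∷ rest)
      ends : lastOf w rest ≡ inj₁ y

  escape : ∀ {u w} → TE t u w → ∃ (LeafWalk u w)
  escape {u} {w} uw with P , y , alt , last ← escape′ (n + k) w u [] (TE-sym uw) (m<m+n (n + k) (s≤s z≤n))
    = y , leafWalk (reverse P) (subst AltWalk (reverse-++ P (w ∷ u ∷ [])) (AltWalk-reverse (P ++ w ∷ u ∷ []) alt)) last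

  record FreshNeighbours (v : Nd) (m : ℕ) (L : List Nd) : Set where
    field
      neighbour : Fin m → Nd
      adjacent  : ∀ p → TE t v (neighbour p)
      fresh     : ∀ p → neighbour p ∉ L
      distinct  : ∀ {p q} → p ≢ q → neighbour p ≢ neighbour q

  fresh-neighbours : ∀ v m L → length L + m ≤ deg t v → FreshNeighbours v m L
  fresh-neighbours v zero    L _ = record { neighbour = λ () ; adjacent = λ () ; fresh = λ () ; distinct = λ { {()} } }
  fresh-neighbours v (suc m) L L+m≤deg
    with L+m<deg ← subst (_≤ deg t v) (+-suc (length L) m) L+m≤deg
    with w , vw , w∉L ← length<deg⇒∃∉ v L (≤-trans (s≤s (m≤m+n (length L) m)) L+m<deg)
    with record { neighbour = a ; adjacent = va ; fresh = a∉ ; distinct = a≢ } ← fresh-neighbours v m (w ∷ L) L+m<deg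
    = record
      { neighbour = w ∷ᶠ a
      ; adjacent  = λ { zero → vw ; (suc p) → va p }
      ; fresh     = λ { zero → w∉L ; (suc p) → a∉ p ∘ there }
      ; distinct  = λ { {zero}  {zero}  0≢0   → ⊥-elim (0≢0 refl)
                      ; {zero}  {suc q} _     → λ w≡aq → a∉ q (here (sym w≡aq))
                      ; {suc p} {zero}  _     → λ ap≡w → a∉ p (here ap≡w)
                      ; {suc p} {suc q} sp≢sq → a≢ (sp≢sq ∘ cong suc) }
      }

  extendThroughClique′ : ∀ {u w j} ws A p → u ∷ w ∷ ws ≡ A ++ p ∷ inj₂ j ∷ [] → Clique t j →
    AltWalk (u ∷ w ∷ ws) →
    ∃ λ p → TE t (inj₂ j) p × (∀ {d y} → TE t (inj₂ j) d → p ≢ d → LeafWalk (inj₂ j) d y → LeafWalk u w y)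
  extendThroughClique′ {u} {w} {j} ws A p split cj alt = p , jp , extend
    where
    alt′ : AltWalk (A ++ p ∷ inj₂ j ∷ [])
    alt′ = subst AltWalk split alt
    jp : TE t (inj₂ j) p
    jp = TE-sym (AltWalk-edge A alt′)
    extend : ∀ {d y} → TE t (inj₂ j) d → p ≢ d → LeafWalk (inj₂ j) d y → LeafWalk u w y
    extend {d} jd p≢d (leafWalk wd altd lastd) = leafWalk (ws ++ d ∷ wd)
      (subst AltWalk (sym (trans (cong (_++ d ∷ wd) split) (++-assoc A (p ∷ inj₂ j ∷ []) (d ∷ wd))))
        (AltWalk-join A alt′ altd (cj p d jp jd p≢d)))
      (trans (lastOf-++ w ws d wd) lastd)

  extendThroughClique : ∀ {u w j} ws → Clique t j → AltWalk (u ∷ w ∷ ws) → lastOf w ws ≡ inj₂ j →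
    ∃ λ p → TE t (inj₂ j) p × (∀ {d y} → TE t (inj₂ j) d → p ≢ d → LeafWalk (inj₂ j) d y → LeafWalk u w y)
  extendThroughClique {u} {w} ws cj alt last with A , p , split ← ∷∷-lastTwo u w ws =
    extendThroughClique′ ws A p (subst (λ z → u ∷ w ∷ ws ≡ A ++ p ∷ z ∷ []) last split) cj alt

  module _ (G : Graph n) (acc : IsAccessibilityGraphOf G t) where

    AltWalk⇒Adj : ∀ {x y} L → AltWalk (inj₁ x ∷ L) → lastOf (inj₁ x) L ≡ inj₁ y → L ≢ [] → Adj G x y
    AltWalk⇒Adj []       _   _    []≢[] = ⊥-elim ([]≢[] refl)
    AltWalk⇒Adj {x} {y} (v ∷ ws) alt last _
      with p , _ , altPath ← AltWalk⇒AltPath (inj₁ x) v ws alt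
         | x∉ ∷ _ ← AltWalk⇒Unique (inj₁ x ∷ v ∷ ws) alt
      = Equivalence.from (acc x y)
          ( (λ { refl → All.lookup x∉ (subst (_∈ v ∷ ws) last (lastOf-∈ v ws)) refl })
          , subst (λ z → AltPath t (inj₁ x) (endAt t z p)) last altPath)

    -- Two leaf walks leaving c through adjacent markers of G_c join into one alternating walk.
    branches⇒Adj : ∀ {c a b y₁ y₂} → LeafWalk c a y₁ → LeafWalk c b y₂ → Turn a c b → Adj G y₁ y₂
    branches⇒Adj {c} {a} {b} {y₁} (leafWalk ws₁ alt₁ last₁) (leafWalk ws₂ alt₂ last₂) acb
      with zs , eq ← reverse-++-∷ a ws₁ (c ∷ b ∷ ws₂) =
      AltWalk⇒Adj (zs ++ c ∷ b ∷ ws₂)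
        (subst AltWalk (trans eq (cong (λ z → z ∷ zs ++ c ∷ b ∷ ws₂) last₁))
          (AltWalk-join (reverse ws₁)
            (subst AltWalk (reverse-++ (c ∷ a ∷ []) ws₁) (AltWalk-reverse (c ∷ a ∷ ws₁) alt₁)) alt₂ acb))
        (trans (lastOf-++ (inj₁ y₁) zs c (b ∷ ws₂)) last₂)
        (λ e → contradiction (++-conicalʳ zs _ e) λ ())

    bigCliqueNode⇒HasLargeClique : ∀ i → Clique t i → 4 ≤ deg t (inj₂ i) → HasLargeClique G
    bigCliqueNode⇒HasLargeClique i ci 4≤deg =
      pairwiseAdjacent⇒HasLargeClique G (proj₁ ∘ fan) ≤-refl
        λ {p} {q} p≢q → branches⇒Adj (proj₂ (fan p)) (proj₂ (fan q)) (ci (a p) (a q) (ia p) (ia q) (a≢ p≢q))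
      where
      open FreshNeighbours (fresh-neighbours (inj₂ i) 4 [] 4≤deg)
        renaming (neighbour to a; adjacent to ia; distinct to a≢)
      fan : ∀ p → ∃ (LeafWalk (inj₂ i) (a p))
      fan p = escape (ia p)

    twoCliqueFans⇒HasLargeClique : ∀ {i j u p} → Clique t i → Clique t j → TE t (inj₂ i) u → TE t (inj₂ j) p →
      (∀ {d y} → TE t (inj₂ j) d → p ≢ d → LeafWalk (inj₂ j) d y → LeafWalk (inj₂ i) u y) → HasLargeClique G
    twoCliqueFans⇒HasLargeClique {i} {j} {u} {p} ci cj iu jp extend =
      pairwiseAdjacent⇒HasLargeClique G (leaf ∘ splitAt 2) ≤-refl
        λ p≢q → adjacent (p≢q ∘ splitAt-injective)
      where
      open FreshNeighbours (fresh-neighbours (inj₂ i) 2 (u ∷ []) (internalDeg i))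
        renaming (neighbour to c; adjacent to ic; fresh to c∉; distinct to c≢)
      open FreshNeighbours (fresh-neighbours (inj₂ j) 2 (p ∷ []) (internalDeg j))
        renaming (neighbour to d; adjacent to jd; fresh to d∉; distinct to d≢)
      fanᵢ : ∀ r → ∃ (LeafWalk (inj₂ i) (c r))
      fanᵢ r = escape (ic r)
      fanⱼ : ∀ r → ∃ (LeafWalk (inj₂ j) (d r))
      fanⱼ r = escape (jd r)
      leaf : Fin 2 ⊎ Fin 2 → Fin n
      leaf = [ proj₁ ∘ fanᵢ , proj₁ ∘ fanⱼ ]′
      splitAt-injective : ∀ {p q : Fin 4} → splitAt 2 p ≡ splitAt 2 q → p ≡ q
      splitAt-injective {p} {q} eq = trans (sym (join-splitAt 2 2 p)) (trans (cong (join 2 2) eq) (join-splitAt 2 2 q))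
      across : ∀ r s → Adj G (proj₁ (fanᵢ r)) (proj₁ (fanⱼ s))
      across r s = branches⇒Adj (proj₂ (fanᵢ r))
        (extend (jd s) (λ p≡d → d∉ s (here (sym p≡d))) (proj₂ (fanⱼ s)))
        (ci (c r) u (ic r) iu (λ c≡u → c∉ r (here c≡u)))
      adjacent : ∀ {p q} → p ≢ q → Adj G (leaf p) (leaf q)
      adjacent {inj₁ r} {inj₁ s} r≢s = branches⇒Adj (proj₂ (fanᵢ r)) (proj₂ (fanᵢ s))
                                         (ci (c r) (c s) (ic r) (ic s) (c≢ (r≢s ∘ cong inj₁)))
      adjacent {inj₁ r} {inj₂ s} _    = across r s
      adjacent {inj₂ r} {inj₁ s} _    = Adj-sym G (across s r)
      adjacent {inj₂ r} {inj₂ s} r≢s = branches⇒Adj (proj₂ (fanⱼ r)) (proj₂ (fanⱼ s))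
                                         (cj (d r) (d s) (jd r) (jd s) (d≢ (r≢s ∘ cong inj₂)))

    ¬HasLargeClique⇒NoBigCliqueNode : ¬ HasLargeClique G → NoBigCliqueNode t
    ¬HasLargeClique⇒NoBigCliqueNode ¬K i ci with 4 ≤? deg t (inj₂ i)
    ... | no  4≰deg = ≰⇒> 4≰deg
    ... | yes 4≤deg = ⊥-elim (¬K (bigCliqueNode⇒HasLargeClique i ci 4≤deg))

    ¬HasLargeClique⇒NoAltPathBetweenCliques : ¬ HasLargeClique G → NoAltPathBetweenCliques t
    ¬HasLargeClique⇒NoAltPathBetweenCliques ¬K i j _ _ i≢j ci cj _ _ altPath
      with AltPath⇒AltWalk altPath (i≢j ∘ inj₂-injective)
    ... | []     , _   , i≡j  = i≢j (inj₂-injective i≡j)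
    ... | u ∷ ws , alt , last with p , jp , extend ← extendThroughClique ws cj alt last
      = ¬K (twoCliqueFans⇒HasLargeClique ci cj (AltWalk-edge [] {R = ws} alt) jp extend)

  AltWalk-upTo : ∀ x P w R → AltWalk (x ∷ P ++ w ∷ R) →
                 Linked (TE t) (x ∷ P ++ w ∷ []) × Unique (x ∷ P ++ w ∷ [])
  AltWalk-upTo x P w R alt = AltWalk⇒Linked _ initial , AltWalk⇒Unique _ initial
    where
    initial : AltWalk (x ∷ P ++ w ∷ [])
    initial = AltWalk-++⁻ˡ (x ∷ P ++ w ∷ []) (subst AltWalk (cong (x ∷_) (sym (++-assoc P (w ∷ []) R))) alt)

  -- A common vertex would be reached from m by two different tree paths.
  AltWalk-forks-disjoint : ∀ m {a b as bs w} → a ≢ b →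
    AltWalk (m ∷ a ∷ as) → AltWalk (m ∷ b ∷ bs) → w ∈ a ∷ as → w ∈ b ∷ bs → ⊥
  AltWalk-forks-disjoint m {a} {b} {as} {bs} {w} a≢b alt₁ alt₂ w∈₁ w∈₂
    with Q₁ , R₁ , e₁ ← ∈-∃++ w∈₁ | Q₂ , R₂ , e₂ ← ∈-∃++ w∈₂
    with l₁ , u₁ ← AltWalk-upTo m Q₁ w R₁ (subst (λ r → AltWalk (m ∷ r)) e₁ alt₁)
       | l₂ , u₂ ← AltWalk-upTo m Q₂ w R₂ (subst (λ r → AltWalk (m ∷ r)) e₂ alt₂)
    with refl ← ++-cancelʳ (w ∷ []) Q₁ Q₂ (tree-path-unique l₁ u₁ l₂ u₂
                  (trans (lastOf-++ m Q₁ w []) (sym (lastOf-++ m Q₂ w []))))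
    = a≢b (heads-agree Q₁ e₁ e₂)

  -- y ⋯ a m b ⋯ z is a tree path, hence the alternating walk from y to z.
  fork⇒Turn : ∀ m {a b as bs y z} wyz → a ≢ b →
    AltWalk (m ∷ a ∷ as) → AltWalk (m ∷ b ∷ bs) → lastOf a as ≡ inj₁ y → lastOf b bs ≡ inj₁ z →
    AltWalk (inj₁ y ∷ wyz) → lastOf (inj₁ y) wyz ≡ inj₁ z → Turn a m b
  fork⇒Turn m {a} {b} {as} {bs} {y} wyz a≢b branch₁ branch₂ last₁ last₂ altyz lastyz =
    AltWalk-turn (reverse as) (subst AltWalk (sym joined≡) (subst (λ r → AltWalk (inj₁ y ∷ r)) (sym path≡) altyz))
    where
    R : List Nd
    R = m ∷ b ∷ bs
    zs : List Nd
    zs = proj₁ (reverse-++-∷ a as R)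
    joined≡ : reverse as ++ a ∷ R ≡ inj₁ y ∷ zs ++ R
    joined≡ = trans (proj₂ (reverse-++-∷ a as R)) (cong (λ v → v ∷ zs ++ R) last₁)
    reverse-++≡ : reverse (a ∷ as) ++ R ≡ reverse as ++ a ∷ R
    reverse-++≡ = trans (cong (_++ R) (unfold-reverse a as)) (∷ʳ-++ (reverse as) a R)
    m∉ : m ∉ a ∷ as
    m∉ = Unique.Unique[x∷xs]⇒x∉xs (AltWalk⇒Unique (m ∷ a ∷ as) branch₁)
    disjoint : ∀ {v} → v ∈ reverse (a ∷ as) × v ∈ R → ⊥
    disjoint (m∈ , here refl) = m∉ (AnyP.reverse⁻ m∈)
    disjoint (v∈ , there v∈′) = AltWalk-forks-disjoint m {as = as} a≢b branch₁ branch₂ (AnyP.reverse⁻ v∈) v∈′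
    joined-linked : Linked (TE t) (reverse (a ∷ as) ++ R)
    joined-linked = Linked-join (reverse (a ∷ as))
      (subst (Linked (TE t)) (unfold-reverse m (a ∷ as)) (AltWalk⇒Linked _ (AltWalk-reverse (m ∷ a ∷ as) branch₁)))
      (AltWalk⇒Linked _ branch₂)
    joined-unique : Unique (reverse (a ∷ as) ++ R)
    joined-unique = Unique.++⁺
      (Unique-reverse {xs = a ∷ as} (Unique-++⁻ʳ (m ∷ []) (AltWalk⇒Unique (m ∷ a ∷ as) branch₁)))
      (AltWalk⇒Unique R branch₂) disjoint
    path≡ : zs ++ R ≡ wyz
    path≡ = tree-path-unique
      (subst (Linked (TE t)) (trans reverse-++≡ joined≡) joined-linked)
      (subst Unique (trans reverse-++≡ joined≡) joined-unique)
      (AltWalk⇒Linked _ altyz) (AltWalk⇒Unique _ altyz)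
      (trans (lastOf-++ (inj₁ y) zs m (b ∷ bs)) (trans last₂ (sym lastyz)))

  -- A star has no triangle.
  triangle⇒Clique : ∀ c {p a b} → IsMarker t c p → IsMarker t c a → IsMarker t c b → p ≢ a → p ≢ b → a ≢ b →
                    T (lab c p a) → T (lab c p b) → T (lab c a b) → Clique t c
  triangle⇒Clique c cp ca cb p≢a p≢b a≢b pa pb ab with cliqueOrStar c
  ... | inj₁ clique = clique
  ... | inj₂ (_ , _ , star)
    with Equivalence.to (star _ _ cp ca p≢a) pa | Equivalence.to (star _ _ cp cb p≢b) pb
       | Equivalence.to (star _ _ ca cb a≢b) ab
  ... | inj₁ refl | _         | inj₁ refl = ⊥-elim (p≢a refl)
  ... | inj₁ refl | _         | inj₂ refl = ⊥-elim (p≢b refl)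
  ... | inj₂ refl | inj₂ refl | _         = ⊥-elim (a≢b refl)
  ... | inj₂ refl | inj₁ refl | _         = ⊥-elim (p≢a refl)

  record Fork (Ly Lz : List Nd) : Set where
    field
      prefix      : List Nd
      entry       : Nd
      node        : Fin k
      exitʸ exitᶻ : Nd
      restʸ restᶻ : List Nd
      splitʸ      : Ly ≡ (prefix ∷ʳ entry) ++ inj₂ node ∷ exitʸ ∷ restʸ
      splitᶻ      : Lz ≡ (prefix ∷ʳ entry) ++ inj₂ node ∷ exitᶻ ∷ restᶻ
      exit≢       : exitʸ ≢ exitᶻ
      clique      : Clique t node

  AltWalk-around : ∀ P {p m a R} → AltWalk ((P ∷ʳ p) ++ m ∷ a ∷ R) → TE t m p × TE t m a × p ≢ a × Turn p m a
  AltWalk-around P {p} {m} {a} {R} alt =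
    TE-sym (AltWalk-edge P alt′) , AltWalk-edge (P ∷ʳ p) alt ,
    Unique-≢ P (m ∷ []) (AltWalk⇒Unique _ alt′) , AltWalk-turn P alt′
    where
    alt′ : AltWalk (P ++ p ∷ m ∷ a ∷ R)
    alt′ = subst AltWalk (∷ʳ-++ P p (m ∷ a ∷ R)) alt

  fork⇒Fork : ∀ P p m {a b as bs y z w₃} → a ≢ b →
    AltWalk ((P ∷ʳ p) ++ m ∷ a ∷ as) → AltWalk ((P ∷ʳ p) ++ m ∷ b ∷ bs) →
    lastOf a as ≡ inj₁ y → lastOf b bs ≡ inj₁ z → LeafWalk (inj₁ y) w₃ z →
    Fork ((P ∷ʳ p) ++ m ∷ a ∷ as) ((P ∷ʳ p) ++ m ∷ b ∷ bs)
  fork⇒Fork P p (inj₁ _) a≢b alt₁ _ _ _ _ with () ← proj₂ (proj₂ (proj₂ (AltWalk-around P alt₁)))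
  fork⇒Fork P p (inj₂ c) {a} {b} {as} {bs} a≢b alt₁ alt₂ last₁ last₂ (leafWalk wyz altyz lastyz)
    with cp , ca , p≢a , pca ← AltWalk-around P alt₁ | _ , cb , p≢b , pcb ← AltWalk-around P alt₂
    = record
      { prefix = P ; entry = p ; node = c ; exitʸ = a ; exitᶻ = b ; restʸ = as ; restᶻ = bs
      ; splitʸ = refl ; splitᶻ = refl ; exit≢ = a≢b
      ; clique = triangle⇒Clique c cp ca cb p≢a p≢b a≢b pca pcb
          (fork⇒Turn (inj₂ c) {as = as} {bs = bs} (_ ∷ wyz) a≢b
                     (AltWalk-++⁻ʳ (P ∷ʳ p) alt₁) (AltWalk-++⁻ʳ (P ∷ʳ p) alt₂) last₁ last₂ altyz lastyz)
      }

  AltWalk-no-inner-leaf : ∀ {u v} ws {d D y} → AltWalk (u ∷ v ∷ ws ++ d ∷ D) → lastOf v ws ≡ inj₁ y → ⊥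
  AltWalk-no-inner-leaf {u} {v} ws {d} {D} alt last with A , a , split ← ∷∷-lastTwo u v ws =
    subst (λ w → Turn a w d) last
      (AltWalk-turn A (subst AltWalk (trans (cong (_++ d ∷ D) split) (++-assoc A _ (d ∷ D))) alt))

  LeafPath : Fin n → Fin n → Set
  LeafPath x y = ∃ λ w → LeafWalk (inj₁ x) w y

  nodes : ∀ {x y} → LeafPath x y → List Nd
  nodes {x} (w , l) = inj₁ x ∷ w ∷ LeafWalk.rest l

  LeafPath⇒AltWalk : ∀ {x y} (l : LeafPath x y) → AltWalk (nodes l)
  LeafPath⇒AltWalk (_ , l) = LeafWalk.walk l

  leaves⇒Fork : ∀ {x y z} → y ≢ z → (l₁ : LeafPath x y) (l₂ : LeafPath x z) → LeafPath y z →
                Fork (nodes l₁) (nodes l₂)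
  leaves⇒Fork {x} y≢z (_ , leafWalk r₁ alt₁ last₁) (_ , leafWalk r₂ alt₂ last₂) (_ , l₃)
    with refl ← leaf-neighbour-unique (AltWalk-edge [] {R = r₁} alt₁) (AltWalk-edge [] {R = r₂} alt₂)
    with diverge _≟N_ r₁ r₂
  ... | equal refl       = ⊥-elim (y≢z (inj₁-injective (trans (sym last₁) last₂)))
  ... | prefixˡ _ _ refl = ⊥-elim (AltWalk-no-inner-leaf r₁ alt₂ last₁)
  ... | prefixʳ _ _ refl = ⊥-elim (AltWalk-no-inner-leaf r₂ alt₁ last₂)
  ... | fork zs a b as bs a≢b refl refl
    with P , p , split ← ∷∷-lastTwo (inj₁ x) _ zs
    = subst₂ Fork (sym (++-lastTwo P p _ (a ∷ as) split)) (sym (++-lastTwo P p _ (b ∷ bs) split))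
        (fork⇒Fork P p _ a≢b
          (subst AltWalk (++-lastTwo P p _ (a ∷ as) split) alt₁)
          (subst AltWalk (++-lastTwo P p _ (b ∷ bs) split) alt₂)
          (trans (sym (lastOf-++ _ zs a as)) last₁) (trans (sym (lastOf-++ _ zs b bs)) last₂) l₃)

  four-neighbours : ∀ {v a b c d} → TE t v a → TE t v b → TE t v c → TE t v d →
                    a ≢ b → a ≢ c → a ≢ d → b ≢ c → b ≢ d → c ≢ d → 4 ≤ deg t v
  four-neighbours {v} va vb vc vd a≢b a≢c a≢d b≢c b≢d c≢d =
    length≤deg v ((a≢b ∷ a≢c ∷ a≢d ∷ []) ∷ (b≢c ∷ b≢d ∷ []) ∷ (c≢d ∷ []) ∷ [] ∷ [])
      λ { (here refl) → va ; (there (here refl)) → vb ; (there (there (here refl))) → vc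
        ; (there (there (there (here refl)))) → vd }

  module _ (noBig : NoBigCliqueNode t) (noAlt : NoAltPathBetweenCliques t) where

    AltWalk⇒¬cliques : ∀ {c c′} v ws → c ≢ c′ → Clique t c → Clique t c′ →
                       AltWalk (inj₂ c ∷ v ∷ ws) → lastOf v ws ≡ inj₂ c′ → ⊥
    AltWalk⇒¬cliques {c} {c′} v ws c≢c′ cc cc′ alt last with p , c′p , altPath ← AltWalk⇒AltPath (inj₂ c) v ws alt =
      noAlt c c′ v p c≢c′ cc cc′ (AltWalk-edge [] {R = ws} alt) (subst (λ z → TE t z p) last c′p)
        (subst (λ z → AltPath t (inj₂ (c , v)) (endAt t z p)) last altPath)

    cliques-apart : ∀ P c M c′ R → AltWalk (P ++ inj₂ c ∷ M ++ inj₂ c′ ∷ R) → Clique t c → Clique t c′ → ⊥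
    cliques-apart P c M c′ R alt cc cc′ = apart M segment
      where
      segment : AltWalk (inj₂ c ∷ M ++ inj₂ c′ ∷ [])
      segment = AltWalk-++⁻ˡ (inj₂ c ∷ M ++ inj₂ c′ ∷ [])
        (subst AltWalk (cong (inj₂ c ∷_) (sym (++-assoc M (inj₂ c′ ∷ []) R))) (AltWalk-++⁻ʳ P alt))
      c≢c′ : ∀ M → AltWalk (inj₂ c ∷ M ++ inj₂ c′ ∷ []) → c ≢ c′
      c≢c′ M alt′ c≡c′ = Unique-≢ [] M (AltWalk⇒Unique _ alt′) (cong inj₂ c≡c′)
      apart : ∀ M → AltWalk (inj₂ c ∷ M ++ inj₂ c′ ∷ []) → ⊥
      apart []      alt′ = AltWalk⇒¬cliques (inj₂ c′) [] (c≢c′ [] alt′) cc cc′ alt′ refl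
      apart (v ∷ M) alt′ =
        AltWalk⇒¬cliques v (M ++ inj₂ c′ ∷ []) (c≢c′ (v ∷ M) alt′) cc cc′ alt′ (lastOf-++ v M (inj₂ c′) [])

    same-fork-node : ∀ {L} P c R Q c′ S → AltWalk L → L ≡ P ++ inj₂ c ∷ R → L ≡ Q ++ inj₂ c′ ∷ S →
                     Clique t c → Clique t c′ → P ≡ Q × c ≡ c′ × R ≡ S
    same-fork-node P c R Q c′ S alt refl eq cc cc′ with compareSplits P (inj₂ c) R Q (inj₂ c′) S eq
    ... | same P≡Q c≡c′ R≡S = P≡Q , inj₂-injective c≡c′ , R≡S
    ... | before M _ refl   = ⊥-elim (cliques-apart P c M c′ S alt cc cc′)
    ... | after M refl S≡   = ⊥-elim (cliques-apart Q c′ M c R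
                                (subst AltWalk (++-assoc Q (inj₂ c′ ∷ M) (inj₂ c ∷ R)) alt) cc′ cc)

    -- All three forks of the walks from the first leaf are at one clique node, which then
    -- has four distinct markers.
    forks⇒⊥ : ∀ {L₂ L₃ L₄} → AltWalk L₂ → AltWalk L₃ → AltWalk L₄ →
              Fork L₂ L₃ → Fork L₂ L₄ → Fork L₃ L₄ → ⊥
    forks⇒⊥ alt₂ alt₃ alt₄
      record { prefix = P ; entry = p ; node = c ; exitʸ = a₂ ; exitᶻ = a₃ ; restʸ = S₂ ; restᶻ = S₃
             ; splitʸ = refl ; splitᶻ = refl ; exit≢ = a₂≢a₃ ; clique = cc }
      record { prefix = Q ; entry = q ; node = c′ ; exitʸ = b₂ ; exitᶻ = b₄ ; restʸ = T₂ ; restᶻ = T₄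
             ; splitʸ = e₂ ; splitᶻ = refl ; exit≢ = b₂≢b₄ ; clique = cc′ }
      record { prefix = R ; entry = r ; node = c″ ; exitʸ = d₃ ; exitᶻ = d₄ ; restʸ = U₃ ; restᶻ = U₄
             ; splitʸ = e₃ ; splitᶻ = e₄ ; exit≢ = d₃≢d₄ ; clique = cc″ }
      with Pp≡Qq , refl , refl
             ← same-fork-node (P ∷ʳ p) c (a₂ ∷ S₂) (Q ∷ʳ q) c′ (b₂ ∷ T₂) alt₂ refl e₂ cc cc′
      with _ , refl , refl ← same-fork-node (P ∷ʳ p) c (a₃ ∷ S₃) (R ∷ʳ r) c″ (d₃ ∷ U₃) alt₃ refl e₃ cc cc″
      with _ , _ , refl ← same-fork-node (Q ∷ʳ q) c (b₄ ∷ T₄) (R ∷ʳ r) c (d₄ ∷ U₄) alt₄ refl e₄ cc cc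
      with refl , refl ← ∷ʳ-injective P Q Pp≡Qq
      with cp , ca₂ , p≢a₂ , _ ← AltWalk-around P alt₂
         | _ , ca₃ , p≢a₃ , _ ← AltWalk-around P alt₃
         | _ , cb₄ , p≢b₄ , _ ← AltWalk-around P alt₄
      = <-irrefl refl (<-≤-trans (noBig c cc)
          (four-neighbours cp ca₂ ca₃ cb₄ p≢a₂ p≢a₃ p≢b₄ a₂≢a₃ b₂≢b₄ d₃≢d₄))

  module _ (G : Graph n) (acc : IsAccessibilityGraphOf G t) where

    Adj⇒LeafPath : ∀ {x y} → Adj G x y → LeafPath x y
    Adj⇒LeafPath {x} {y} xy with x≢y , altPath ← Equivalence.to (acc x y) xy
      with AltPath⇒AltWalk altPath (x≢y ∘ inj₁-injective)
    ... | []     , _   , x≡y  = ⊥-elim (x≢y (inj₁-injective x≡y))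
    ... | w ∷ ws , alt , last = w , leafWalk ws alt last

    noBig×noAlt⇒¬HasLargeClique : NoBigCliqueNode t → NoAltPathBetweenCliques t → ¬ HasLargeClique G
    noBig×noAlt⇒¬HasLargeClique noBig noAlt (suc (suc (suc (suc _))) , s≤s (s≤s (s≤s (s≤s _))) , f , f-inj , adj) =
      forks⇒⊥ noBig noAlt (LeafPath⇒AltWalk l₀₁) (LeafPath⇒AltWalk l₀₂) (LeafPath⇒AltWalk l₀₃)
        (leaves⇒Fork (f-inj⁻ {1F} {2F} λ ()) l₀₁ l₀₂ l₁₂)
        (leaves⇒Fork (f-inj⁻ {1F} {3F} λ ()) l₀₁ l₀₃ l₁₃)
        (leaves⇒Fork (f-inj⁻ {2F} {3F} λ ()) l₀₂ l₀₃ l₂₃)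
      where
      f-inj⁻ : ∀ {p q} → p ≢ q → f p ≢ f q
      f-inj⁻ p≢q = p≢q ∘ f-inj
      l₀₁ : LeafPath (f 0F) (f 1F)
      l₀₁ = Adj⇒LeafPath (adj 0F 1F λ ())
      l₀₂ : LeafPath (f 0F) (f 2F)
      l₀₂ = Adj⇒LeafPath (adj 0F 2F λ ())
      l₀₃ : LeafPath (f 0F) (f 3F)
      l₀₃ = Adj⇒LeafPath (adj 0F 3F λ ())
      l₁₂ : LeafPath (f 1F) (f 2F)
      l₁₂ = Adj⇒LeafPath (adj 1F 2F λ ())
      l₁₃ : LeafPath (f 1F) (f 3F)
      l₁₃ = Adj⇒LeafPath (adj 1F 3F λ ())
      l₂₃ : LeafPath (f 2F) (f 3F)
      l₂₃ = Adj⇒LeafPath (adj 2F 3F λ ())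

lemma9 : ∀ {n k : ℕ} (G : Graph n) (t : GLT n k) →
    Connected G → ReducedCliqueStar t → IsAccessibilityGraphOf G t →
    ((¬ HasLargeClique G) ⇔ (NoBigCliqueNode t × NoAltPathBetweenCliques t))
lemma9 G t _ RC acc = mk⇔
  (λ ¬K → ¬HasLargeClique⇒NoBigCliqueNode G acc ¬K , ¬HasLargeClique⇒NoAltPathBetweenCliques G acc ¬K)
  (λ (noBig , noAlt) → noBig×noAlt⇒¬HasLargeClique G acc noBig noAlt)
  where open SplitTree t RC
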